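{- Let $S$ be a skip set with $|S|\le4$ and let $m=\max S$. Then every cycle in $G(S)$ contains at most one $m$-arc.
   Context: A skip set is a finite set of positive integers. The skip graph $G(S)$ is the simple graph with vertex set $\mathbb{N}=\{0,1,2,\dots\}$ in which, for each $s\in S$ and each integer $j\ge0$, the vertices $2js$ and $(2j+1)s$ are joined by an edge called an $s$-arc (each edge is an $s$-arc for exactly one $s$, namely its length). A cycle is a graph cycle (length at least 3, distinct vertices). -}

module Defs where

open import Data.Nat using (ℕ; zero; suc; _+_; _*_; _≤_; _<_)
open import Data.Nat.Properties using (_≟_)
open import Data.Product using (Σ; ∃; _×_; _,_)
open import Data.Sum using (_⊎_)
open import Data.List using (List; length)
open import Data.List.Membership.Propositional using (_∈_)
open import Data.List.Relation.Unary.All using (All)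
open import Data.List.Relation.Unary.Unique.Propositional using (Unique)
open import Relation.Binary.PropositionalEquality using (_≡_)
open import Relation.Nullary using (yes; no)

-- A skip set: a finite set of positive integers, represented by a
-- duplicate-free list (so its cardinality is the list length).
record SkipSet : Set where
  constructor mkSkipSet
  field
    elems    : List ℕ
    positive : All (λ s → 0 < s) elems
    unique   : Unique elems

open SkipSet public

Arc : ℕ → ℕ → ℕ → Set
Arc s u v = ∃ λ j → (u ≡ 2 * j * s × v ≡ (2 * j + 1) * s)
                  ⊎ (v ≡ 2 * j * s × u ≡ (2 * j + 1) * s)

Adj : SkipSet → ℕ → ℕ → Set
Adj S u v = Σ ℕ λ s → s ∈ elems S × Arc s u v

nxt : ℕ → ℕ → ℕ
nxt k i with suc i ≟ k
... | yes _ = 0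
... | no  _ = suc i

record Cycle (S : SkipSet) : Set where
  constructor mkCycle
  field
    len      : ℕ
    vtx      : ℕ → ℕ
    len≥3    : 3 ≤ len
    distinct : ∀ i j → i < len → j < len → vtx i ≡ vtx j → i ≡ j
    adjacent : ∀ i → i < len → Adj S (vtx i) (vtx (nxt len i))

open Cycle public

IsMax : SkipSet → ℕ → Set
IsMax S m = m ∈ elems S × All (λ s → s ≤ m) (elems S)

-- An s-arc lies over the unit interval (z, z + 1) exactly when z mod 2s < s, so along the
-- line each length s of S contributes a square wave of period 2s.  Suppose a cycle uses two
-- distinct m-arcs; they lie in distinct blocks [2jm, (2j + 1)m].  Then the cycle contains
-- the left end 2jm of the lower one and climbs above 2jm + 2m to reach the upper one;
-- leaving and returning, it crosses every unit interval of [2jm, 2jm + 2m) at least twice,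
-- and two crossing arcs of equal length would coincide.  As m is off on [2jm + m, 2jm + 2m),
-- the at most three other lengths must cover [L, L + m) twice and [L - m, L) at least once,
-- where L = 2jm + m.  Two lengths cannot: one of them would be on at two points a
-- half-period apart.  For three lengths a < b < c, the phases of c and b at L pin down
-- where b and c are off inside [L, L + c]; there a is forced on, and comparing these runs of
-- a produces a point of [L - a, L) at which all three waves are off.

module Submission where

open import Defs
open import Data.Nat using (ℕ; zero; suc; _+_; _*_; _∸_; _≤_; _<_; z≤n; s≤s; _≟_; _≤?_; _<?_; >-nonZero)
open import Data.Nat.DivMod using (_%_; _/_; m≡m%n+[m/n]*n; m%n<n)
open import Data.Nat.Properties
open import Data.Nat.Tactic.RingSolver using (solve-∀)
open import Data.Empty using (⊥; ⊥-elim)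
open import Data.List using (List; []; _∷_; length; filter)
open import Data.List.Properties using (filter-notAll)
open import Data.List.Membership.Propositional using (_∈_)
open import Data.List.Membership.Propositional.Properties using (∈-filter⁺; ∈-filter⁻)
open import Data.List.Relation.Binary.Permutation.Propositional using (_↭_; ↭-sym; ↭⇒↭ₛ)
open import Data.List.Relation.Binary.Permutation.Propositional.Properties
  using (∈-resp-↭; All-resp-↭; ↭-length)
open import Data.List.Relation.Unary.All using (All; []; _∷_)
import Data.List.Relation.Unary.All as All
open import Data.List.Relation.Unary.AllPairs using ([]; _∷_)
open import Data.List.Relation.Unary.Any using (here; there)
import Data.List.Relation.Unary.Any as Any
open import Data.List.Relation.Unary.Linked using ([]; [-]; _∷_)
open import Data.List.Relation.Unary.Unique.Propositional using (Unique)
open import Data.List.Relation.Unary.Unique.Propositional.Properties using (filter⁺)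
open import Data.Product using (∃-syntax; _×_; _,_; proj₁; proj₂)
open import Data.Sum using (_⊎_; inj₁; inj₂)
open import Relation.Binary.Definitions using (tri<; tri≈; tri>)
open import Relation.Binary.PropositionalEquality
open import Relation.Nullary using (¬_; ¬?; Dec; yes; no)
open import Data.List.Relation.Unary.Sorted.TotalOrder ≤-totalOrder using (Sorted)
open import Data.List.Sort ≤-decTotalOrder using (sort; sort-↭; sort-↗)
open import Data.List.Relation.Binary.Permutation.Setoid.Properties (setoid ℕ) using (Unique-resp-↭)

-- Covered s z: the unit interval (z, z + 1) lies under the s-arc joining 2js and (2j + 1)s.
Covered : ℕ → ℕ → Set
Covered s z = ∃[ j ] j * (s + s) ≤ z × z < j * (s + s) + s

Uncovered : ℕ → ℕ → Set
Uncovered s z = ∃[ j ] j * (s + s) + s ≤ z × z < j * (s + s) + (s + s)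

*-step : ∀ k {i j} → i < j → i * k + k ≤ j * k
*-step k {i} {j} i<j = subst (_≤ j * k) (+-comm k (i * k)) (*-monoˡ-≤ k i<j)

block-index-≤ : ∀ k {i j x y} → i * k ≤ x → x ≤ y → y < j * k + k → i ≤ j
block-index-≤ k {i} {j} ik≤x x≤y y<jk+k with i ≤? j
... | yes i≤j = i≤j
... | no i≰j = ⊥-elim (<-irrefl refl
        (<-≤-trans y<jk+k (≤-trans (*-step k (≰⇒> i≰j)) (≤-trans ik≤x x≤y))))

block-index-< : ∀ k {s i j x y} → i * k ≤ x → y < j * k + s → x + s ≤ y → i < j
block-index-< k {s} {i} {j} ik≤x y<jk+s x+s≤y with i <? j
... | yes i<j = i<j
... | no i≮j = ⊥-elim (<-irrefl refl (<-≤-trans y<jk+s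
                 (≤-trans (+-monoˡ-≤ s (≤-trans (*-monoˡ-≤ k (≮⇒≥ i≮j)) ik≤x)) x+s≤y)))

covered-index-unique : ∀ {s z i j} → i * (s + s) ≤ z → z < i * (s + s) + s →
                       j * (s + s) ≤ z → z < j * (s + s) + s → i ≡ j
covered-index-unique {s} {z} {i} {j} iK≤z z<iK+s jK≤z z<jK+s = ≤-antisym
  (block-index-≤ (s + s) iK≤z ≤-refl (<-≤-trans z<jK+s (+-monoʳ-≤ (j * (s + s)) (m≤m+n s s))))
  (block-index-≤ (s + s) jK≤z ≤-refl (<-≤-trans z<iK+s (+-monoʳ-≤ (i * (s + s)) (m≤m+n s s))))

covered⇒¬uncovered : ∀ {s z} → Covered s z → ¬ Uncovered s z
covered⇒¬uncovered {s} {z} (i , iK≤z , z<iK+s) (j , jK+s≤z , z<jK+K)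
  with ≤-antisym {i} {j} (block-index-≤ (s + s) iK≤z ≤-refl z<jK+K)
         (block-index-≤ (s + s) (≤-trans (m≤m+n _ s) jK+s≤z) ≤-refl
           (<-≤-trans z<iK+s (+-monoʳ-≤ (i * (s + s)) (m≤m+n s s))))
... | refl = <-irrefl refl (<-≤-trans z<iK+s jK+s≤z)

covered-or-uncovered-in-block : ∀ {s} q r → r < s + s →
  Covered s (r + q * (s + s)) ⊎ Uncovered s (r + q * (s + s))
covered-or-uncovered-in-block {s} q r r<K with r <? s
... | yes r<s = inj₁ (q , m≤n+m _ r , subst (r + q * (s + s) <_) (+-comm s _) (+-monoˡ-< (q * (s + s)) r<s))
... | no r≮s  = inj₂ (q , subst (_≤ r + q * (s + s)) (+-comm s _) (+-monoˡ-≤ (q * (s + s)) (≮⇒≥ r≮s))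
                        , subst (r + q * (s + s) <_) (+-comm (s + s) _) (+-monoˡ-< (q * (s + s)) r<K))

covered⊎uncovered : ∀ {s} → 0 < s → ∀ z → Covered s z ⊎ Uncovered s z
covered⊎uncovered {s} s>0 z =
  subst (λ x → Covered s x ⊎ Uncovered s x) (sym (m≡m%n+[m/n]*n z (s + s)))
        (covered-or-uncovered-in-block (z / (s + s)) (z % (s + s)) (m%n<n z (s + s)))
  where instance _ = >-nonZero (<-≤-trans s>0 (m≤m+n s s))

covered⇒uncovered+ : ∀ {s z} → Covered s z → Uncovered s (z + s)
covered⇒uncovered+ {s} {z} (j , jK≤z , z<jK+s) =
  j , +-monoˡ-≤ s jK≤z , subst (z + s <_) (+-assoc (j * (s + s)) s s) (+-monoˡ-< s z<jK+s)

¬covered-twice : ∀ {s z} → Covered s z → ¬ Covered s (z + s)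
¬covered-twice c c′ = covered⇒¬uncovered c′ (covered⇒uncovered+ c)

covered+⇒uncovered : ∀ {s} → 0 < s → ∀ x → Covered s (x + s) → Uncovered s x
covered+⇒uncovered s>0 x c with covered⊎uncovered s>0 x
... | inj₁ c′ = ⊥-elim (¬covered-twice c′ c)
... | inj₂ u = u

covered-interval-≤ : ∀ {s x y} → (∀ z → x ≤ z → z < y → Covered s z) → y ≤ x + s
covered-interval-≤ {s} {x} {y} cov with y ≤? x + s
... | yes y≤x+s = y≤x+s
... | no y≰x+s = ⊥-elim (¬covered-twice (cov x ≤-refl (≤-<-trans (m≤m+n x s) x+s<y)) (cov (x + s) (m≤m+n x s) x+s<y))
  where x+s<y = ≰⇒> y≰x+s

covered-run-end : ∀ {s j x y} → 0 < s → j * (s + s) ≤ x → x < j * (s + s) + s →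
                  (∀ z → x ≤ z → z < y → Covered s z) → y ≤ j * (s + s) + s
covered-run-end {s} {j} {x} {y} s>0 jK≤x x<jK+s cov with y ≤? j * (s + s) + s
... | yes y≤end = y≤end
... | no y≰end = ⊥-elim (covered⇒¬uncovered (cov (j * (s + s) + s) (<⇒≤ x<jK+s) (≰⇒> y≰end))
                           (j , ≤-refl , subst (j * (s + s) + s <_) (+-assoc _ s s) (m<m+n _ s>0)))

uncovered-before-block : ∀ s j x → j * (s + s) ≤ x + s → x < j * (s + s) → Uncovered s x
uncovered-before-block s zero x _ ()
uncovered-before-block s (suc i) x [1+i]K≤x+s x<[1+i]K =
  i , +-cancelʳ-≤ s _ _ (subst (_≤ x + s) [1+i]K≡iK+s+s [1+i]K≤x+s)
    , subst (x <_) (+-comm (s + s) _) x<[1+i]K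
  where
  [1+i]K≡iK+s+s : suc i * (s + s) ≡ i * (s + s) + s + s
  [1+i]K≡iK+s+s = trans (+-comm (s + s) _) (sym (+-assoc (i * (s + s)) s s))

TwoCover : List ℕ → ℕ → Set
TwoCover T z = ∃[ s ] ∃[ t ] s ∈ T × t ∈ T × s ≢ t × Covered s z × Covered t z

OneCover : List ℕ → ℕ → Set
OneCover T z = ∃[ s ] s ∈ T × Covered s z

two-of-three : ∀ {a b c z} → TwoCover (a ∷ b ∷ c ∷ []) z →
  (Covered a z × Covered b z) ⊎ (Covered a z × Covered c z) ⊎ (Covered b z × Covered c z)
two-of-three (_ , _ , here refl , here refl , s≢t , _) = ⊥-elim (s≢t refl)
two-of-three (_ , _ , here refl , there (here refl) , _ , ca , cb) = inj₁ (ca , cb)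
two-of-three (_ , _ , here refl , there (there (here refl)) , _ , ca , cc) = inj₂ (inj₁ (ca , cc))
two-of-three (_ , _ , there (here refl) , here refl , _ , cb , ca) = inj₁ (ca , cb)
two-of-three (_ , _ , there (here refl) , there (here refl) , s≢t , _) = ⊥-elim (s≢t refl)
two-of-three (_ , _ , there (here refl) , there (there (here refl)) , _ , cb , cc) = inj₂ (inj₂ (cb , cc))
two-of-three (_ , _ , there (there (here refl)) , here refl , _ , cc , ca) = inj₂ (inj₁ (ca , cc))
two-of-three (_ , _ , there (there (here refl)) , there (here refl) , _ , cc , cb) = inj₂ (inj₂ (cb , cc))
two-of-three (_ , _ , there (there (here refl)) , there (there (here refl)) , s≢t , _) = ⊥-elim (s≢t refl)

one-of-three : ∀ {a b c z} → OneCover (a ∷ b ∷ c ∷ []) z →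
               Uncovered a z → Uncovered b z → Uncovered c z → ⊥
one-of-three (_ , here refl , ca) ua _ _ = covered⇒¬uncovered ca ua
one-of-three (_ , there (here refl) , cb) _ ub _ = covered⇒¬uncovered cb ub
one-of-three (_ , there (there (here refl)) , cc) _ _ uc = covered⇒¬uncovered cc uc

+-right-comm : ∀ x y z → x + y + z ≡ x + z + y
+-right-comm = solve-∀

module ThreeLengths {a b c L : ℕ} (a>0 : 0 < a) (a<b : a < b) (b<c : b < c) (a≤L : a ≤ L)
  (two : ∀ z → L ≤ z → z ≤ L + c → TwoCover (a ∷ b ∷ c ∷ []) z)
  (one : ∀ z → L ≤ z + a → z < L → OneCover (a ∷ b ∷ c ∷ []) z) where

  a<c : a < c
  a<c = <-trans a<b b<c

  c-uncovered⇒a,b-covered : ∀ {z} → L ≤ z → z ≤ L + c → Uncovered c z → Covered a z × Covered b z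
  c-uncovered⇒a,b-covered L≤z z≤L+c uc with two-of-three (two _ L≤z z≤L+c)
  ... | inj₁ ab = ab
  ... | inj₂ (inj₁ (_ , cc)) = ⊥-elim (covered⇒¬uncovered cc uc)
  ... | inj₂ (inj₂ (_ , cc)) = ⊥-elim (covered⇒¬uncovered cc uc)

  b-uncovered⇒a,c-covered : ∀ {z} → L ≤ z → z ≤ L + c → Uncovered b z → Covered a z × Covered c z
  b-uncovered⇒a,c-covered L≤z z≤L+c ub with two-of-three (two _ L≤z z≤L+c)
  ... | inj₁ (_ , cb) = ⊥-elim (covered⇒¬uncovered cb ub)
  ... | inj₂ (inj₁ ac) = ac
  ... | inj₂ (inj₂ (cb , _)) = ⊥-elim (covered⇒¬uncovered cb ub)

  -- During a b-gap inside the window a is forced on, but a gap outlasts a run of a.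
  b-gap-leaves-window : ∀ k → L ≤ k * (b + b) + b → k * (b + b) + (b + b) ≤ L + c → ⊥
  b-gap-leaves-window k L≤G E≤L+c =
    ¬covered-twice (a-covers G ≤-refl (m<m+n G (<-trans a>0 a<b)))
                   (a-covers (G + a) (m≤m+n G a) (+-monoʳ-< G a<b))
    where
    G : ℕ
    G = k * (b + b) + b
    a-covers : ∀ z → G ≤ z → z < G + b → Covered a z
    a-covers z G≤z z<G+b = proj₁ (b-uncovered⇒a,c-covered (≤-trans L≤G G≤z)
      (≤-trans (<⇒≤ z<E) E≤L+c) (k , G≤z , z<E))
      where
      z<E : z < k * (b + b) + (b + b)
      z<E = subst (z <_) (+-assoc _ b b) z<G+b

  -- The two stretches lie in different runs of a, since the second reaches L + c > L + a.
  a-runs-apart : ∀ {X Y} → L < X → Y ≤ L + c →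
                 (∀ z → L ≤ z → z < X → Covered a z) → (∀ z → Y ≤ z → z ≤ L + c → Covered a z) →
                 X + a ≤ Y × L + c < Y + a
  a-runs-apart {X} {Y} L<X Y≤L+c before after
    with before L ≤-refl L<X | after Y ≤-refl Y≤L+c
  ... | (i , R≤L , L<R+a) | (i′ , R′≤Y , Y<R′+a) =
    ≤-trans (≤-trans (+-monoˡ-≤ a X≤R+a) (≤-reflexive (+-assoc (i * (a + a)) a a)))
            (≤-trans (*-step (a + a) i<i′) R′≤Y)
    , <-≤-trans L+c<R′+a (+-monoˡ-≤ a R′≤Y)
    where
    X≤R+a : X ≤ i * (a + a) + a
    X≤R+a = covered-run-end {j = i} a>0 R≤L L<R+a before
    L+c<R′+a : L + c < i′ * (a + a) + a
    L+c<R′+a = covered-run-end {j = i′} a>0 R′≤Y Y<R′+a (λ z Y≤z z≤L+c → after z Y≤z (≤-pred z≤L+c))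
    i<i′ : i < i′
    i<i′ = block-index-< (a + a) R≤L L+c<R′+a (+-monoʳ-≤ L (<⇒≤ a<c))

  x₀ : ℕ
  x₀ = L ∸ a

  x₀+a≡L : x₀ + a ≡ L
  x₀+a≡L = m∸n+n≡m a≤L

  x₀<L : x₀ < L
  x₀<L = subst (x₀ <_) x₀+a≡L (m<m+n x₀ a>0)

  x₀+y+a≡L+y : ∀ y → x₀ + y + a ≡ L + y
  x₀+y+a≡L+y y = trans (+-right-comm x₀ y a) (cong (_+ y) x₀+a≡L)

  a-uncovered-at-x₀ : Covered a L → Uncovered a x₀
  a-uncovered-at-x₀ ca = covered+⇒uncovered a>0 x₀ (subst (Covered a) (sym x₀+a≡L) ca)

  b-covered-at-x₀ : Uncovered a x₀ → Uncovered c x₀ → Covered b x₀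
  b-covered-at-x₀ ua uc with covered⊎uncovered (<-trans a>0 a<b) x₀
  ... | inj₁ cb = cb
  ... | inj₂ ub = ⊥-elim (one-of-three (one x₀ (≤-reflexive (sym x₀+a≡L)) x₀<L) ua ub uc)

  b-block-start≤x₀ : ∀ k → k * (b + b) ≤ L → Covered b x₀ → k * (b + b) ≤ x₀
  b-block-start≤x₀ k Q≤L (k′ , Q′≤x₀ , x₀<Q′+b) = ≤-trans (*-monoˡ-≤ (b + b) k≤k′) Q′≤x₀
    where
    open ≤-Reasoning
    k≤k′ : k ≤ k′
    k≤k′ = block-index-≤ (b + b) Q≤L ≤-refl (begin-strict
      L                        ≡⟨ x₀+a≡L ⟨
      x₀ + a                   <⟨ +-monoʳ-< x₀ a<b ⟩
      x₀ + b                   <⟨ +-monoˡ-< b x₀<Q′+b ⟩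
      k′ * (b + b) + b + b     ≡⟨ +-assoc _ b b ⟩
      k′ * (b + b) + (b + b)   ∎)

  -- Then b covers x₀ = L - a, so its run through L ends by L - a + b, while a-runs-apart
  -- pushes that end past L + c - a.
  module CUncoveredAtL (jc kb : ℕ) (P≤L : jc * (c + c) + c ≤ L) (L<U : L < jc * (c + c) + (c + c))
                       (Q≤L : kb * (b + b) ≤ L) (L<E : L < kb * (b + b) + b) (ca : Covered a L) where
    open ≤-Reasoning
    P U Q E : ℕ
    P = jc * (c + c) + c
    U = jc * (c + c) + (c + c)
    Q = kb * (b + b)
    E = Q + b

    E≤L+c : E ≤ L + c
    E≤L+c = +-mono-≤ Q≤L (<⇒≤ b<c)
    L+c<E+b : L + c < E + b
    L+c<E+b with L + c <? E + b
    ... | yes L+c<E+b = L+c<E+b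
    ... | no L+c≮E+b = ⊥-elim (b-gap-leaves-window kb (<⇒≤ L<E)
                                 (subst (_≤ L + c) (+-assoc Q b b) (≮⇒≥ L+c≮E+b)))
    U≤L+c : U ≤ L + c
    U≤L+c = subst (_≤ L + c) (+-assoc _ c c) (+-monoˡ-≤ c P≤L)

    a-before-U : ∀ z → L ≤ z → z < U → Covered a z
    a-before-U z L≤z z<U = proj₁ (c-uncovered⇒a,b-covered L≤z (≤-trans (<⇒≤ z<U) U≤L+c)
                                    (jc , ≤-trans P≤L L≤z , z<U))
    a-after-E : ∀ z → E ≤ z → z ≤ L + c → Covered a z
    a-after-E z E≤z z≤L+c = proj₁ (b-uncovered⇒a,c-covered (≤-trans (<⇒≤ L<E) E≤z) z≤L+c
      (kb , E≤z , subst (z <_) (+-assoc Q b b) (≤-<-trans z≤L+c L+c<E+b)))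
    runs : U + a ≤ E × L + c < E + a
    runs = a-runs-apart L<U E≤L+c a-before-U a-after-E

    P≤x₀ : P ≤ x₀
    P≤x₀ = +-cancelʳ-≤ (a + c) P x₀ (begin
      P + (a + c)  ≡⟨ U+a≡P+[a+c] (jc * (c + c)) a c ⟨
      U + a        ≤⟨ ≤-trans (proj₁ runs) E≤L+c ⟩
      L + c        ≡⟨ cong (_+ c) x₀+a≡L ⟨
      x₀ + a + c   ≡⟨ +-assoc x₀ a c ⟩
      x₀ + (a + c) ∎)
      where
      U+a≡P+[a+c] : ∀ q a c → q + (c + c) + a ≡ q + c + (a + c)
      U+a≡P+[a+c] = solve-∀

    Q≤x₀ : Q ≤ x₀
    Q≤x₀ = b-block-start≤x₀ kb Q≤L
             (b-covered-at-x₀ (a-uncovered-at-x₀ ca) (jc , P≤x₀ , <-trans x₀<L L<U))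

    c<b : c < b
    c<b = +-cancelˡ-< L c b (begin-strict
      L + c       <⟨ proj₂ runs ⟩
      E + a       ≤⟨ +-monoˡ-≤ a (+-monoˡ-≤ b Q≤x₀) ⟩
      x₀ + b + a  ≡⟨ x₀+y+a≡L+y b ⟩
      L + b       ∎)

    absurd : ⊥
    absurd = <-asym b<c c<b

  ¬c,b-covered-at-L : Covered c L → Covered b L → ⊥
  ¬c,b-covered-at-L cc (kb , Q≤L , L<Q+b)
    with proj₂ (c-uncovered⇒a,b-covered (m≤m+n L c) ≤-refl (covered⇒uncovered+ cc))
  ... | k₂ , Q₂≤L+c , L+c<Q₂+b =
    b-gap-leaves-window kb (<⇒≤ L<Q+b)
      (≤-trans (*-step (b + b) (block-index-< (b + b) {i = kb} {j = k₂} Q≤L L+c<Q₂+b (+-monoʳ-≤ L (<⇒≤ b<c)))) Q₂≤L+c)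

  b-gap-starts-past-window : ∀ k → L ≤ k * (b + b) + b → Uncovered c (L + c) →
                             L + c < k * (b + b) + b
  b-gap-starts-past-window k L≤G uc with L + c <? k * (b + b) + b
  ... | yes L+c<G = L+c<G
  ... | no L+c≮G with L + c <? k * (b + b) + (b + b)
  ...   | yes L+c<E = ⊥-elim (covered⇒¬uncovered
            (proj₂ (c-uncovered⇒a,b-covered (m≤m+n L c) ≤-refl uc)) (k , ≮⇒≥ L+c≮G , L+c<E))
  ...   | no L+c≮E = ⊥-elim (b-gap-leaves-window k L≤G (≮⇒≥ L+c≮E))

  -- The start G of b's gap through L is a point of [L - a, L) where a, b and c are all off.
  module CCoveredBUncoveredAtL (jc kb : ℕ) (P≤L : jc * (c + c) ≤ L) (L<U : L < jc * (c + c) + c)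
                               (G≤L : kb * (b + b) + b ≤ L) (L<kK+K : L < kb * (b + b) + (b + b)) where
    open ≤-Reasoning
    P U G E : ℕ
    P = jc * (c + c)
    U = P + c
    G = kb * (b + b) + b
    E = G + b

    E≡kK+K : E ≡ kb * (b + b) + (b + b)
    E≡kK+K = +-assoc (kb * (b + b)) b b
    G<E : G < E
    G<E = m<m+n G (<-trans a>0 a<b)
    L<E : L < E
    L<E = subst (L <_) (sym E≡kK+K) L<kK+K
    E≤L+c : E ≤ L + c
    E≤L+c = +-mono-≤ G≤L (<⇒≤ b<c)
    U≤L+c : U ≤ L + c
    U≤L+c = +-monoˡ-≤ c P≤L
    c-uncovered-at-L+c : Uncovered c (L + c)
    c-uncovered-at-L+c = covered⇒uncovered+ (jc , P≤L , L<U)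

    a-before-E : ∀ z → L ≤ z → z < E → Covered a z
    a-before-E z L≤z z<E = proj₁ (b-uncovered⇒a,c-covered L≤z (≤-trans (<⇒≤ z<E) E≤L+c)
                                    (kb , ≤-trans G≤L L≤z , subst (z <_) E≡kK+K z<E))
    a-after-U : ∀ z → U ≤ z → z ≤ L + c → Covered a z
    a-after-U z U≤z z≤L+c = proj₁ (c-uncovered⇒a,b-covered (≤-trans (<⇒≤ L<U) U≤z) z≤L+c
      (jc , U≤z , <-≤-trans (≤-<-trans z≤L+c (+-monoˡ-< c L<U)) (≤-reflexive (+-assoc P c c))))
    E≤L+a : E ≤ L + a
    E≤L+a = covered-interval-≤ a-before-E
    runs : E + a ≤ U × L + c < U + a
    runs = a-runs-apart L<E U≤L+c a-before-E a-after-U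

    c<a+b : c < a + b
    c<a+b = +-cancelˡ-< L c (a + b) (begin-strict
      L + c        <⟨ b-gap-starts-past-window (suc kb) (≤-trans (<⇒≤ L<E) E≤next-gap) c-uncovered-at-L+c ⟩
      suc kb * (b + b) + b ≡⟨ next-gap≡E+b (kb * (b + b)) b ⟩
      E + b        ≤⟨ +-monoˡ-≤ b E≤L+a ⟩
      L + a + b    ≡⟨ +-assoc L a b ⟩
      L + (a + b)  ∎)
      where
      next-gap≡E+b : ∀ q b → b + b + q + b ≡ q + b + b + b
      next-gap≡E+b = solve-∀
      E≤next-gap : E ≤ suc kb * (b + b) + b
      E≤next-gap = ≤-trans (m≤m+n E b) (≤-reflexive (sym (next-gap≡E+b (kb * (b + b)) b)))

    x₀<P : x₀ < P
    x₀<P = +-cancelʳ-< (a + c) x₀ P (begin-strict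
      x₀ + (a + c) ≡⟨ +-assoc x₀ a c ⟨
      x₀ + a + c   ≡⟨ cong (_+ c) x₀+a≡L ⟩
      L + c        <⟨ proj₂ runs ⟩
      P + c + a    ≡⟨ +-assoc P c a ⟩
      P + (c + a)  ≡⟨ cong (P +_) (+-comm c a) ⟩
      P + (a + c)  ∎)
    P≤x₀+c : P ≤ x₀ + c
    P≤x₀+c = ≤-trans P≤L (subst (_≤ x₀ + c) x₀+a≡L (+-monoʳ-≤ x₀ (<⇒≤ a<c)))

    x₀<G : x₀ < G
    x₀<G with x₀ <? G
    ... | yes x₀<G = x₀<G
    ... | no x₀≮G = ⊥-elim (covered⇒¬uncovered
      (b-covered-at-x₀ (a-uncovered-at-x₀ (a-before-E L ≤-refl L<E)) (uncovered-before-block c jc x₀ P≤x₀+c x₀<P))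
      (kb , ≮⇒≥ x₀≮G , subst (x₀ <_) E≡kK+K (<-trans x₀<L L<E)))

    L≤G+a : L ≤ G + a
    L≤G+a = subst (_≤ G + a) x₀+a≡L (+-monoˡ-≤ a (<⇒≤ x₀<G))
    G<L : G < L
    G<L = +-cancelʳ-< b G L (≤-<-trans E≤L+a (+-monoʳ-< L a<b))
    a-uncovered-at-G : Uncovered a G
    a-uncovered-at-G = covered+⇒uncovered a>0 G (a-before-E (G + a) L≤G+a (+-monoʳ-< G a<b))
    c-uncovered-at-G : Uncovered c G
    c-uncovered-at-G = uncovered-before-block c jc G (≤-trans P≤L (≤-trans L≤G+a (+-monoʳ-≤ G (<⇒≤ a<c)))) G<P
      where
      G<P : G < P
      G<P with G <? P
      ... | yes G<P = G<P
      ... | no G≮P = ⊥-elim (<-irrefl refl (<-≤-trans c<a+b (+-cancelˡ-≤ G (a + b) c (begin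
        G + (a + b)  ≡⟨ cong (G +_) (+-comm a b) ⟩
        G + (b + a)  ≡⟨ +-assoc G b a ⟨
        E + a        ≤⟨ proj₁ runs ⟩
        P + c        ≤⟨ +-monoˡ-≤ c (≮⇒≥ G≮P) ⟩
        G + c        ∎))))

    absurd : ⊥
    absurd = one-of-three (one G L≤G+a G<L) a-uncovered-at-G (kb , ≤-refl , subst (G <_) E≡kK+K G<E) c-uncovered-at-G

  impossible : ⊥
  impossible with covered⊎uncovered (<-trans a>0 a<c) L
  ... | inj₂ (jc , P≤L , L<U) with c-uncovered⇒a,b-covered ≤-refl (m≤m+n L c) (jc , P≤L , L<U)
  ...   | ca , (kb , Q≤L , L<E) = CUncoveredAtL.absurd jc kb P≤L L<U Q≤L L<E ca
  impossible | inj₁ (jc , P≤L , L<U) with covered⊎uncovered (<-trans a>0 a<b) L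
  ... | inj₁ cb = ¬c,b-covered-at-L (jc , P≤L , L<U) cb
  ... | inj₂ (kb , G≤L , L<E) = CCoveredBUncoveredAtL.absurd jc kb P≤L L<U G≤L L<E


TwoCover-⊆ : ∀ {T T′ z} → (∀ {s} → s ∈ T → s ∈ T′) → TwoCover T z → TwoCover T′ z
TwoCover-⊆ T⊆T′ (s , t , s∈T , t∈T , s≢t , cs , ct) = s , t , T⊆T′ s∈T , T⊆T′ t∈T , s≢t , cs , ct

OneCover-⊆ : ∀ {T T′ z} → (∀ {s} → s ∈ T → s ∈ T′) → OneCover T z → OneCover T′ z
OneCover-⊆ T⊆T′ (s , s∈T , cs) = s , T⊆T′ s∈T , cs

TwoCover-pair⇒covered : ∀ {x y z} → TwoCover (x ∷ y ∷ []) z → Covered y z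
TwoCover-pair⇒covered (_ , _ , here refl , here refl , s≢t , _) = ⊥-elim (s≢t refl)
TwoCover-pair⇒covered (_ , _ , here refl , there (here refl) , _ , _ , cy) = cy
TwoCover-pair⇒covered (_ , _ , there (here refl) , _ , _ , cy , _) = cy

¬double-cover-by-sorted : ∀ {m L} (T : List ℕ) → Unique T → Sorted T → length T ≤ 3 →
  All (λ t → 0 < t × t < m) T → 0 < m → m ≤ L →
  (∀ z → L ≤ z → z < L + m → TwoCover T z) → (∀ z → L ≤ z + m → z < L → OneCover T z) → ⊥
¬double-cover-by-sorted {m} {L} [] _ _ _ _ m>0 _ two _ with two L ≤-refl (m<m+n L m>0)
... | _ , _ , () , _
¬double-cover-by-sorted {m} {L} (x ∷ []) _ _ _ _ m>0 _ two _ with two L ≤-refl (m<m+n L m>0)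
... | _ , _ , here refl , here refl , s≢t , _ = s≢t refl
¬double-cover-by-sorted {m} {L} (x ∷ y ∷ []) _ _ _ (_ ∷ (_ , y<m) ∷ []) m>0 _ two _ =
  ¬covered-twice (covered L ≤-refl (m<m+n L m>0)) (covered (L + y) (m≤m+n L y) (+-monoʳ-< L y<m))
  where
  covered : ∀ z → L ≤ z → z < L + m → Covered y z
  covered z L≤z z<L+m = TwoCover-pair⇒covered (two z L≤z z<L+m)
¬double-cover-by-sorted {m} {L} (a ∷ b ∷ c ∷ []) ((a≢b ∷ _ ∷ []) ∷ (b≢c ∷ []) ∷ [] ∷ []) (a≤b ∷ b≤c ∷ [-]) _
  ((a>0 , a<m) ∷ _ ∷ (_ , c<m) ∷ []) _ m≤L two one =
  ThreeLengths.impossible a>0 (≤∧≢⇒< a≤b a≢b) (≤∧≢⇒< b≤c b≢c) (≤-trans (<⇒≤ a<m) m≤L)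
    (λ z L≤z z≤L+c → two z L≤z (≤-<-trans z≤L+c (+-monoʳ-< L c<m)))
    (λ z L≤z+a z<L → one z (≤-trans L≤z+a (+-monoʳ-≤ z (<⇒≤ a<m))) z<L)
¬double-cover-by-sorted (_ ∷ _ ∷ _ ∷ _ ∷ _) _ _ (s≤s (s≤s (s≤s ()))) _ _ _ _ _

¬double-cover-by-three : ∀ {m L} (T : List ℕ) → Unique T → length T ≤ 3 →
  All (λ t → 0 < t × t < m) T → 0 < m → m ≤ L →
  (∀ z → L ≤ z → z < L + m → TwoCover T z) → (∀ z → L ≤ z + m → z < L → OneCover T z) → ⊥
¬double-cover-by-three T unique-T len-T bounds m>0 m≤L two one =
  ¬double-cover-by-sorted (sort T) (Unique-resp-↭ (↭⇒↭ₛ T↭sorted) unique-T) (sort-↗ T)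
    (subst (_≤ 3) (↭-length T↭sorted) len-T) (All-resp-↭ T↭sorted bounds) m>0 m≤L
    (λ z L≤z z<L+m → TwoCover-⊆ (∈-resp-↭ T↭sorted) (two z L≤z z<L+m))
    (λ z L≤z+m z<L → OneCover-⊆ (∈-resp-↭ T↭sorted) (one z L≤z+m z<L))
  where
  T↭sorted : T ↭ sort T
  T↭sorted = ↭-sym (sort-↭ T)

¬double-cover-of-max-period : (S : SkipSet) → length (elems S) ≤ 4 → ∀ m → IsMax S m → ∀ j →
  (∀ z → j * (m + m) ≤ z → z < j * (m + m) + (m + m) → TwoCover (elems S) z) → ⊥
¬double-cover-of-max-period S len-S m (m∈S , all≤m) j two =
  ¬double-cover-by-three T (filter⁺ ≢m? (unique S)) len-T bounds m>0 (m≤n+m m _) two-T one-T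
  where
  ≢m? = λ x → ¬? (x ≟ m)
  T : List ℕ
  T = filter ≢m? (elems S)
  L : ℕ
  L = j * (m + m) + m
  m>0 : 0 < m
  m>0 = All.lookup (positive S) m∈S

  len-T : length T ≤ 3
  len-T = ≤-pred (≤-trans (filter-notAll ≢m? (elems S) (Any.map (λ m≡x x≢m → x≢m (sym m≡x)) m∈S)) len-S)
  bounds : All (λ t → 0 < t × t < m) T
  bounds = All.tabulate λ t∈T → let (t∈S , t≢m) = ∈-filter⁻ ≢m? {xs = elems S} t∈T in
    All.lookup (positive S) t∈S , ≤∧≢⇒< (All.lookup all≤m t∈S) t≢m
  covered⇒∈T : ∀ {s z} → s ∈ elems S → Covered s z → Uncovered m z → s ∈ T
  covered⇒∈T s∈S cs um = ∈-filter⁺ ≢m? s∈S λ { refl → covered⇒¬uncovered cs um }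

  two-T : ∀ z → L ≤ z → z < L + m → TwoCover T z
  two-T z L≤z z<L+m = avoid-m (two z (≤-trans (m≤m+n _ m) L≤z) z<jK+K)
    where
    z<jK+K : z < j * (m + m) + (m + m)
    z<jK+K = subst (z <_) (+-assoc _ m m) z<L+m
    um : Uncovered m z
    um = j , L≤z , z<jK+K
    avoid-m : TwoCover (elems S) z → TwoCover T z
    avoid-m (s , t , s∈S , t∈S , s≢t , cs , ct) =
      s , t , covered⇒∈T s∈S cs um , covered⇒∈T t∈S ct um , s≢t , cs , ct
  one-T : ∀ z → L ≤ z + m → z < L → OneCover T z
  one-T z L≤z+m z<L with two z (+-cancelʳ-≤ m _ _ L≤z+m) (<-trans z<L (subst (L <_) (+-assoc _ m m) (m<m+n L m>0)))
  ... | s , t , s∈S , t∈S , s≢t , cs , ct with s ≟ m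
  ...   | no s≢m = s , ∈-filter⁺ ≢m? s∈S s≢m , cs
  ...   | yes refl = t , ∈-filter⁺ ≢m? t∈S (λ t≡s → s≢t (sym t≡s)) , ct

nxt<n : ∀ n i → i < n → nxt n i < n
nxt<n n i i<n with suc i ≟ n
... | yes _ = ≤-trans (s≤s z≤n) i<n
... | no 1+i≢n = ≤∧≢⇒< i<n 1+i≢n

nxt-suc : ∀ n i → suc i < n → nxt n i ≡ suc i
nxt-suc n i 1+i<n with suc i ≟ n
... | yes 1+i≡n = ⊥-elim (<-irrefl 1+i≡n 1+i<n)
... | no _ = refl

nxt-last : ∀ l → nxt (suc l) l ≡ 0
nxt-last l with suc l ≟ suc l
... | yes _ = refl
... | no 1+l≢1+l = ⊥-elim (1+l≢1+l refl)

nxt∘nxt≢id : ∀ n i → 3 ≤ n → i < n → nxt n (nxt n i) ≢ i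
nxt∘nxt≢id n i 3≤n i<n with suc i ≟ n
... | yes 1+i≡n rewrite nxt-suc n 0 (≤-trans (s≤s (s≤s z≤n)) 3≤n) =
  λ 1≡i → <-irrefl (trans (cong suc 1≡i) 1+i≡n) 3≤n
... | no _ with suc (suc i) ≟ n
...   | yes 2+i≡n = λ 0≡i → <-irrefl (subst (λ t → suc (suc t) ≡ n) (sym 0≡i) 2+i≡n) 3≤n
...   | no _ = λ 2+i≡i → <-irrefl (sym 2+i≡i) (m<n⇒m<1+n (n<1+n i))

module _ {P : ℕ → Set} (P? : ∀ x → Dec (P x)) where

  boundary : ∀ {i} j → P i → ¬ P j → i ≤ j → ∃[ e ] e < j × P e × ¬ P (suc e)
  boundary zero Pi ¬P0 z≤n = ⊥-elim (¬P0 Pi)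
  boundary (suc j) Pi ¬P[1+j] i≤1+j with P? j
  ... | yes Pj = j , ≤-refl , Pj , ¬P[1+j]
  ... | no ¬Pj with m≤n⇒m<n∨m≡n i≤1+j
  ...   | inj₂ refl = ⊥-elim (¬P[1+j] Pi)
  ...   | inj₁ i<1+j with boundary j Pi ¬Pj (≤-pred i<1+j)
  ...     | e , e<j , Pe , ¬P[1+e] = e , m<n⇒m<1+n e<j , Pe , ¬P[1+e]

  boundary-within : ∀ {n} j → j < n → ∃[ e ] e < j × P e × ¬ P (suc e) →
                    ∃[ e ] e < n × P e × ¬ P (nxt n e)
  boundary-within {n} j j<n (e , e<j , Pe , ¬P[1+e]) =
    e , <-trans e<j j<n , Pe , subst (λ x → ¬ P x) (sym (nxt-suc n e (≤-<-trans e<j j<n))) ¬P[1+e]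

  cyclic-boundary : ∀ {n p k} → p < n → k < n → P p → ¬ P k → ∃[ e ] e < n × P e × ¬ P (nxt n e)
  cyclic-boundary {suc l} {k = k} p<n k<n Pp ¬Pk with P? l
  ... | no ¬Pl = boundary-within l ≤-refl (boundary l Pp ¬Pl (≤-pred p<n))
  ... | yes Pl with P? 0
  ...   | no ¬P0 = l , ≤-refl , Pl , subst (λ x → ¬ P x) (sym (nxt-last l)) ¬P0
  ...   | yes P0 = boundary-within k k<n (boundary k P0 ¬Pk z≤n)

2js≡j[s+s] : ∀ j s → 2 * j * s ≡ j * (s + s)
2js≡j[s+s] = solve-∀

[2j+1]s≡j[s+s]+s : ∀ j s → (2 * j + 1) * s ≡ j * (s + s) + s
[2j+1]s≡j[s+s]+s = solve-∀

module _ {S : SkipSet} (C : Cycle S) where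

  private
    n : ℕ
    n = len C
    v : ℕ → ℕ
    v = vtx C

  Joins : ℕ → ℕ → ℕ → Set
  Joins e x y = (v e ≡ x × v (nxt n e) ≡ y) ⊎ (v e ≡ y × v (nxt n e) ≡ x)

  Crosses : ℕ → ℕ → Set
  Crosses e z = (v e ≤ z × z < v (nxt n e)) ⊎ (v (nxt n e) ≤ z × z < v e)

  ¬reversed-edges : ∀ {e e′} → e < n → e′ < n → v e ≡ v (nxt n e′) → v (nxt n e) ≡ v e′ → ⊥
  ¬reversed-edges {e} {e′} e<n e′<n ve≡vne′ vne≡ve′ =
    nxt∘nxt≢id n e (len≥3 C) e<n (trans (cong (nxt n) ne≡e′) (sym e≡ne′))
    where
    e≡ne′ : e ≡ nxt n e′
    e≡ne′ = distinct C _ _ e<n (nxt<n n e′ e′<n) ve≡vne′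
    ne≡e′ : nxt n e ≡ e′
    ne≡e′ = distinct C _ _ (nxt<n n e e<n) e′<n vne≡ve′

  Joins-unique : ∀ {e e′ x y} → e < n → e′ < n → Joins e x y → Joins e′ x y → e ≡ e′
  Joins-unique e<n e′<n (inj₁ (ve , _)) (inj₁ (ve′ , _)) = distinct C _ _ e<n e′<n (trans ve (sym ve′))
  Joins-unique e<n e′<n (inj₂ (ve , _)) (inj₂ (ve′ , _)) = distinct C _ _ e<n e′<n (trans ve (sym ve′))
  Joins-unique e<n e′<n (inj₁ (ve , vne)) (inj₂ (ve′ , vne′)) =
    ⊥-elim (¬reversed-edges e<n e′<n (trans ve (sym vne′)) (trans vne (sym ve′)))
  Joins-unique e<n e′<n (inj₂ (ve , vne)) (inj₁ (ve′ , vne′)) =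
    ⊥-elim (¬reversed-edges e<n e′<n (trans ve (sym vne′)) (trans vne (sym ve′)))

  Arc⇒Joins : ∀ {s e} → Arc s (v e) (v (nxt n e)) → ∃[ j ] Joins e (j * (s + s)) (j * (s + s) + s)
  Arc⇒Joins {s} (j , inj₁ (ve , vne)) = j , inj₁ (trans ve (2js≡j[s+s] j s) , trans vne ([2j+1]s≡j[s+s]+s j s))
  Arc⇒Joins {s} (j , inj₂ (vne , ve)) = j , inj₂ (trans ve ([2j+1]s≡j[s+s]+s j s) , trans vne (2js≡j[s+s] j s))

  Joins⇒Crosses⇒inside : ∀ {e x y z} → x ≤ y → Joins e x y → Crosses e z → x ≤ z × z < y
  Joins⇒Crosses⇒inside x≤y (inj₁ (refl , refl)) (inj₁ crossing) = crossing
  Joins⇒Crosses⇒inside x≤y (inj₁ (refl , refl)) (inj₂ (y≤z , z<x)) = ⊥-elim (<-irrefl refl (<-≤-trans z<x (≤-trans x≤y y≤z)))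
  Joins⇒Crosses⇒inside x≤y (inj₂ (refl , refl)) (inj₁ (y≤z , z<x)) = ⊥-elim (<-irrefl refl (<-≤-trans z<x (≤-trans x≤y y≤z)))
  Joins⇒Crosses⇒inside x≤y (inj₂ (refl , refl)) (inj₂ crossing) = crossing

  crossing-arc : ∀ {e z} → e < n → Crosses e z →
    ∃[ s ] s ∈ elems S × ∃[ j ] (j * (s + s) ≤ z × z < j * (s + s) + s) × Joins e (j * (s + s)) (j * (s + s) + s)
  crossing-arc {e} e<n crosses with adjacent C e e<n
  ... | s , s∈S , arc with Arc⇒Joins arc
  ...   | j , joins = s , s∈S , j , Joins⇒Crosses⇒inside (m≤m+n _ s) joins crosses , joins

  ascent-descent⇒TwoCover : ∀ {e₁ e₂ z} → e₁ < n → e₂ < n →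
    v e₁ ≤ z × z < v (nxt n e₁) → v (nxt n e₂) ≤ z × z < v e₂ → TwoCover (elems S) z
  ascent-descent⇒TwoCover e₁<n e₂<n up down
    with crossing-arc e₁<n (inj₁ up) | crossing-arc e₂<n (inj₂ down)
  ... | s₁ , s₁∈S , j₁ , (p₁ , q₁) , joins₁ | s₂ , s₂∈S , j₂ , (p₂ , q₂) , joins₂ =
    s₁ , s₂ , s₁∈S , s₂∈S , s₁≢s₂ , (j₁ , p₁ , q₁) , (j₂ , p₂ , q₂)
    where
    -- Equal lengths would put both crossings on one arc, hence on one edge, crossed both ways.
    s₁≢s₂ : s₁ ≢ s₂
    s₁≢s₂ refl with covered-index-unique {i = j₁} {j = j₂} p₁ q₁ p₂ q₂
    ... | refl with Joins-unique e₁<n e₂<n joins₁ joins₂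
    ...   | refl = <-irrefl refl (≤-<-trans (proj₁ down) (proj₂ up))

  crossed-both-ways : ∀ {p k z} → p < n → k < n → v p ≤ z → z < v k → TwoCover (elems S) z
  crossed-both-ways {p} {k} {z} p<n k<n vp≤z z<vk
    with cyclic-boundary (λ i → v i ≤? z) p<n k<n vp≤z (<⇒≱ z<vk)
       | cyclic-boundary (λ i → z <? v i) k<n p<n z<vk (≤⇒≯ vp≤z)
  ... | e₁ , e₁<n , up , ¬up | e₂ , e₂<n , down , ¬down =
    ascent-descent⇒TwoCover e₁<n e₂<n (up , ≰⇒> ¬up) (≮⇒≥ ¬down , down)

  Joins⇒endpoints : ∀ {e x y} → e < n → Joins e x y → (∃[ p ] p < n × v p ≡ x) × (∃[ q ] q < n × v q ≡ y)
  Joins⇒endpoints {e} e<n (inj₁ (ve , vne)) = (e , e<n , ve) , (nxt n e , nxt<n n e e<n , vne)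
  Joins⇒endpoints {e} e<n (inj₂ (ve , vne)) = (nxt n e , nxt<n n e e<n , vne) , (e , e<n , ve)

  module _ (len-S : length (elems S) ≤ 4) {m} (max-m : IsMax S m) where

    ¬max-arcs-in-increasing-blocks : ∀ {i j i′ j′} → i < n → j < n →
      Joins i (i′ * (m + m)) (i′ * (m + m) + m) → Joins j (j′ * (m + m)) (j′ * (m + m) + m) → i′ < j′ → ⊥
    ¬max-arcs-in-increasing-blocks {i′ = i′} i<n j<n joins-i joins-j i′<j′
      with Joins⇒endpoints i<n joins-i | Joins⇒endpoints j<n joins-j
    ... | (p , p<n , vp) , _ | _ , (k , k<n , vk) =
      ¬double-cover-of-max-period S len-S m max-m i′ λ z lo hi →
        crossed-both-ways p<n k<n (subst (_≤ z) (sym vp) lo)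
          (subst (z <_) (sym vk) (<-≤-trans hi (≤-trans (*-step (m + m) i′<j′) (m≤m+n _ m))))

    max-arcs-share-block : ∀ {i j i′ j′} → i < n → j < n →
      Joins i (i′ * (m + m)) (i′ * (m + m) + m) → Joins j (j′ * (m + m)) (j′ * (m + m) + m) → i′ ≡ j′
    max-arcs-share-block {i′ = i′} {j′} i<n j<n joins-i joins-j with <-cmp i′ j′
    ... | tri< i′<j′ _ _ = ⊥-elim (¬max-arcs-in-increasing-blocks i<n j<n joins-i joins-j i′<j′)
    ... | tri≈ _ i′≡j′ _ = i′≡j′
    ... | tri> _ _ j′<i′ = ⊥-elim (¬max-arcs-in-increasing-blocks j<n i<n joins-j joins-i j′<i′)

claim19 : (S : SkipSet) → length (elems S) ≤ 4 → (m : ℕ) → IsMax S m →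
    (C : Cycle S) → ∀ i j → i < len C → j < len C →
    Arc m (vtx C i) (vtx C (nxt (len C) i)) →
    Arc m (vtx C j) (vtx C (nxt (len C) j)) → i ≡ j
claim19 S len-S m max-m C i j i<n j<n arc-i arc-j with Arc⇒Joins C arc-i | Arc⇒Joins C arc-j
... | i′ , joins-i | j′ , joins-j with max-arcs-share-block C len-S max-m {i′ = i′} {j′} i<n j<n joins-i joins-j
... | refl = Joins-unique C i<n j<n joins-i joins-j
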